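{- In Martin-Löf type theory $\mathbf{ML}$, the E-category $\mathbf{Types}$ of small types is closed for pseudo-relations.
   Context: $\mathbf{ML}$ is intensional Martin-Löf type theory with $\Sigma$-types, $\Pi$-types, identity types $=_X$, binary sum types $+$, natural numbers, finite types, and a universe $\mathcal{U}$ closed under these type formers. The E-category $\mathbf{Types}$ has as objects the small types $X:\mathcal{U}$; arrows $X\to Y$ are function terms $f:X\to Y$, and two arrows $f,g$ are equal if there is a closed term of $\prod_{x:X}f(x)=_Y g(x)$. Finite products are $\Sigma$-types; a weak equaliser of $f,g\colon X\to Y$ is $\mathrm{pr}_1\colon\sum_{x:X}f(x)=_Yg(x)\to X$. Global elements $x\in X$ are closed terms of $X$ (arrows from the unit type), and for an arrow $a\colon A\to X$, $x\in_a$ means there is a closed $u:A$ with $a(u)=x$ (in the sense of equality of arrows). Statements about existence are interpreted as existence of closed terms. Closed for pseudo-relations: for $g\colon Y\to X$, $f\colon X\to I$, a family of pseudo-relations over $f,g$ is a pair of arrows $h\colon J\to I$, $r\colon R\to J\times X\times Y$ with, for all elements, (a) $\langle j,x,y\rangle\in_r\Rightarrow gy=x$ and (b) $fx=hj\iff\exists y\in Y\,\langle j,x,y\rangle\in_r$. A pseudo-relation over $f,g$ with domain index $i\in I$ is $r\colon R\to X\times Y$ with $\langle x,y\rangle\in_r\Rightarrow gy=x$ and $fx=i\iff\exists y\,\langle x,y\rangle\in_r$. A full family over $f,g$ is a family $\phi\colon F\to I$, $\alpha\colon P\to F\times X\times Y$ over $f,g$ such that for every pseudo-relation $r$ over $f,g$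 with domain index $i$ there is $c\in F$ with $\phi c=i$ and $\langle c,x,y\rangle\in_\alpha\Rightarrow\langle x,y\rangle\in_r$ for all $x,y$. The category is closed for pseudo-relations if every composable pair has a full family. -}

module Defs where

open import Level using (0ℓ)
open import Data.Product using (Σ; _×_; _,_; proj₁)
open import Function.Bundles using (_⇔_)
open import Relation.Binary.PropositionalEquality using (_≡_)

-- The E-category Types: objects are small types (Set = the universe U),
-- arrows are functions, and arrows are equal when pointwise propositionally
-- equal.

_∈[_] : {A X : Set} → X → (A → X) → Set
x ∈[ a ] = Σ _ λ u → a u ≡ x

record FamilyOfPseudoRelations {I X Y : Set} (f : X → I) (g : Y → X) : Set₁ where
  field
    J   : Set
    h   : J → I
    R   : Set
    r   : R → J × X × Y
    rel-a : ∀ j x y → (j , x , y) ∈[ r ] → g y ≡ x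
    rel-b : ∀ j x → (f x ≡ h j) ⇔ (Σ Y λ y → (j , x , y) ∈[ r ])

record PseudoRelation {I X Y : Set} (f : X → I) (g : Y → X) (i : I) : Set₁ where
  field
    R   : Set
    r   : R → X × Y
    rel-a : ∀ x y → (x , y) ∈[ r ] → g y ≡ x
    rel-b : ∀ x → (f x ≡ i) ⇔ (Σ Y λ y → (x , y) ∈[ r ])

record FullFamily {I X Y : Set} (f : X → I) (g : Y → X) : Set₁ where
  field
    family : FamilyOfPseudoRelations f g
  open FamilyOfPseudoRelations family public
    renaming (J to F; h to φ; R to P; r to α)
  field
    full : ∀ (i : I) (ρ : PseudoRelation f g i) →
           Σ F λ c → (φ c ≡ i) ×
             (∀ x y → (c , x , y) ∈[ α ] → (x , y) ∈[ PseudoRelation.r ρ ])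

ClosedForPseudoRelations : Set₁
ClosedForPseudoRelations =
  ∀ {I X Y : Set} (f : X → I) (g : Y → X) → FullFamily f g

module Submission where

-- A pseudo-relation over f, g with domain index i is, up to
-- containment, the same thing as a choice, for every x in the f-fibre over i,
-- of a g-preimage of x: condition (b) provides some y related to x and
-- condition (a) says g y ≡ x.  The full family is therefore indexed by all
-- pairs (i , s) of an index i and such a choice s of preimages, and relates
-- (i , s) to the points (x , s x) of the graph of s.

open import Defs
open import Data.Product using (Σ; _×_; _,_; proj₁; proj₂)
open import Function.Bundles using (_⇔_; mk⇔; module Equivalence)
open import Relation.Binary.PropositionalEquality using (_≡_; refl)

module _ {I X Y : Set} (f : X → I) (g : Y → X) where

  PreimageChoice : I → Set
  PreimageChoice i = (x : X) → f x ≡ i → Σ Y λ y → g y ≡ x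

  module Graph {J : Set} (h : J → I) (s : (j : J) → PreimageChoice (h j)) where

    Point : Set
    Point = Σ J λ j → Σ X λ x → f x ≡ h j

    graph : Point → J × X × Y
    graph (j , x , p) = j , x , proj₁ (s j x p)

    graph-member : ∀ j x y → (j , x , y) ∈[ graph ] →
                   Σ (f x ≡ h j) λ p → proj₁ (s j x p) ≡ y
    graph-member j x _ ((j , x , p) , refl) = p , refl

    graph-lies-over-g : ∀ j x y → (j , x , y) ∈[ graph ] → g y ≡ x
    graph-lies-over-g j x y m with graph-member j x y m
    ... | p , refl = proj₂ (s j x p)

    graph-total : ∀ j x → (f x ≡ h j) ⇔ (Σ Y λ y → (j , x , y) ∈[ graph ])
    graph-total j x = mk⇔
      (λ p → proj₁ (s j x p) , ((j , x , p) , refl))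
      (λ (y , m) → proj₁ (graph-member j x y m))

    graphFamily : FamilyOfPseudoRelations f g
    graphFamily = record
      { J = J ; h = h ; R = Point ; r = graph
      ; rel-a = graph-lies-over-g
      ; rel-b = graph-total }

  module _ {i : I} (ρ : PseudoRelation f g i) where
    open PseudoRelation ρ

    related : ∀ x → f x ≡ i → Σ Y λ y → (x , y) ∈[ r ]
    related x = Equivalence.to (rel-b x)

    choiceOf : PreimageChoice i
    choiceOf x p = let (y , m) = related x p in y , rel-a x y m

    choiceOf-contained : ∀ x p → (x , proj₁ (choiceOf x p)) ∈[ r ]
    choiceOf-contained x p = proj₂ (related x p)

  AllChoices : Set
  AllChoices = Σ I PreimageChoice

  open Graph {AllChoices} proj₁ proj₂
    using (graphFamily; graph; graph-member)

  graph-of-choiceOf-contained :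
    ∀ {i} (ρ : PseudoRelation f g i) x y →
    ((i , choiceOf ρ) , x , y) ∈[ graph ] → (x , y) ∈[ PseudoRelation.r ρ ]
  graph-of-choiceOf-contained {i} ρ x y m with graph-member (i , choiceOf ρ) x y m
  ... | p , refl = choiceOf-contained ρ x p

  fullFamily : FullFamily f g
  fullFamily = record
    { family = graphFamily
    ; full = λ i ρ → (i , choiceOf ρ) , refl , graph-of-choiceOf-contained ρ }

proposition4p10 : ClosedForPseudoRelations
proposition4p10 = fullFamily
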